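{- For all integers $k\geq 3$ and $n\geq 2$, the snake graph $S_{k,n}$ is total prime.
   Context: All graphs are finite and simple. For a graph $G$ with vertex set $V$ and edge set $E$, a total prime labeling is a bijection $\ell: V\cup E\to\{1,2,\ldots,|V|+|E|\}$ such that (i) for every pair of adjacent vertices $u,v$, $\gcd(\ell(u),\ell(v))=1$, and (ii) for every vertex $v$ of degree at least 2, the greatest common divisor of the labels $\ell(uv)$ over all edges $uv$ incident to $v$ equals 1. A graph is total prime if it admits a total prime labeling. The snake graph $S_{k,n}$ consists of a path $v_1,v_2,\ldots,v_{n+1}$ together with, for each $i=1,\ldots,n$, a cycle $v_i,w_{i,1},\ldots,w_{i,k-2},v_{i+1},v_i$ of length $k$, where all the vertices $w_{i,j}$ are new and distinct; thus it is $n$ copies of $C_k$ attached so that one edge of each cycle lies on the path $P_{n+1}$. It has $n(k-1)+1$ vertices and $nk$ edges. -}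

module Defs where

open import Level using (0ℓ)
open import Data.Nat using (ℕ; zero; suc; _+_; _*_; _∸_; _<?_)
open import Data.Nat.Divisibility using (_∣_)
open import Data.Nat.Coprimality using (Coprime)
open import Data.Fin using (Fin; toℕ; fromℕ<; inject₁) renaming (suc to fsuc)
open import Data.Product using (_×_; _,_; proj₁; proj₂; ∃-syntax)
open import Data.Sum using (_⊎_; inj₁; inj₂)
open import Function.Bundles using (_⤖_; Bijection)
open import Relation.Binary.PropositionalEquality using (_≡_; _≢_)
open import Relation.Nullary using (yes; no)

record Graph : Set₁ where
  field
    V    : Set
    E    : Set
    ends : E → V × V

open Graph public

Incident : (G : Graph) → E G → V G → Set
Incident G e v = proj₁ (ends G e) ≡ v ⊎ proj₂ (ends G e) ≡ v

DegAtLeast2 : (G : Graph) → V G → Set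
DegAtLeast2 G v = ∃[ e₁ ] ∃[ e₂ ] (e₁ ≢ e₂ × Incident G e₁ v × Incident G e₂ v)

-- A total prime labeling with labels {1,…,N}: a bijection
-- ℓ : V ⊎ E → Fin N, the label of x being 1 + toℕ (ℓ x).
-- N must equal |V| + |E| (forced by the bijection).
record TotalPrimeLabeling (G : Graph) (N : ℕ) : Set where
  field
    ℓ : (V G ⊎ E G) ⤖ Fin N
  lab : V G ⊎ E G → ℕ
  lab x = suc (toℕ (Bijection.to ℓ x))
  field
    adjCoprime : ∀ e → Coprime (lab (inj₁ (proj₁ (ends G e))))
                               (lab (inj₁ (proj₂ (ends G e))))
    -- (ii) for deg(v) ≥ 2, gcd of incident edge labels is 1, i.e.
    -- every common divisor of those labels equals 1
    edgeGcd : ∀ v → DegAtLeast2 G v →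
              ∀ d → (∀ e → Incident G e v → d ∣ lab (inj₂ e)) → d ≡ 1

TotalPrime : (G : Graph) (N : ℕ) → Set
TotalPrime G N = TotalPrimeLabeling G N

-- The snake graph S_{k,n}.
-- Vertices: path vertices v_i (i = 0..n, i.e. v_1..v_{n+1} of the paper)
-- and inner vertices w_{i,j} (i = 0..n-1, j = 0..k-3).

data SnakeV (k n : ℕ) : Set where
  pathV  : Fin (suc n) → SnakeV k n
  innerV : Fin n → Fin (k ∸ 2) → SnakeV k n

-- Edges: the path edge v_i v_{i+1}, and the k-1 edges of the path
-- v_i, w_{i,0}, …, w_{i,k-3}, v_{i+1} (edge t joins node t and node t+1).
data SnakeE (k n : ℕ) : Set where
  pathE  : Fin n → SnakeE k n
  cycleE : Fin n → Fin (k ∸ 1) → SnakeE k n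

-- node s (s = 0..k-1) of the i-th cycle path v_i, w_{i,0}, …, w_{i,k-3}, v_{i+1}
cycleNode : (k n : ℕ) → Fin n → ℕ → SnakeV k n
cycleNode k n i zero = pathV (inject₁ i)
cycleNode k n i (suc s) with s <? k ∸ 2
... | yes p = innerV i (fromℕ< p)
... | no _  = pathV (fsuc i)

snakeEnds : (k n : ℕ) → SnakeE k n → SnakeV k n × SnakeV k n
snakeEnds k n (pathE i)    = pathV (inject₁ i) , pathV (fsuc i)
snakeEnds k n (cycleE i t) = cycleNode k n i (toℕ t) , cycleNode k n i (suc (toℕ t))

Snake : (k n : ℕ) → Graph
Snake k n = record { V = SnakeV k n ; E = SnakeE k n ; ends = snakeEnds k n }

-- |V| + |E| = (n(k-1)+1) + nk
snakeLabelCount : (k n : ℕ) → ℕ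
snakeLabelCount k n = (n * (k ∸ 1) + 1) + n * k

-- Label the vertices 1, 2, 3, … in the order in which a walk along the snake meets them:
-- v₀, the inner vertices of the first cycle, v₁, the inner vertices of the second cycle,
-- v₂, …  Consecutive vertices of a cycle then carry consecutive labels, and the ends of a
-- path edge vᵢvᵢ₊₁ carry 1 + i(k−1) and 1 + (i+1)(k−1), which are coprime because a common
-- divisor divides k − 1, hence i(k−1), hence 1.  The edges take the remaining labels in the
-- order v₀v₁, the edges of the first cycle, and then for each later cycle its k − 1 cycle
-- edges followed by its path edge.  In that order every vertex lies on two edges with
-- consecutive labels, so the gcd of the labels around it is 1.  (For v₁ these are the last
-- edge of the first cycle and the first edge of the second, which is where n ≥ 2 is used.)
module Submission where

open import Defs
open import Data.Nat using (ℕ; zero; suc; _+_; _*_; _≤_; _<_; _≥_; _<?_; s≤s; s≤s⁻¹)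
open import Data.Nat.Properties
  using (+-comm; +-assoc; +-suc; +-identityʳ; *-suc; *-zeroʳ;
         ≤-antisym; ≮⇒≥; <-irrefl; <⇒≤)
open import Data.Nat.Divisibility using (_∣_; ∣m+n∣m⇒∣n; ∣m⇒∣m*n; ∣1⇒≡1)
open import Data.Nat.Coprimality using (Coprime)
open import Data.Fin using (Fin; toℕ; fromℕ; fromℕ<; inject₁; combine)
  renaming (zero to fzero; suc to fsuc)
open import Data.Fin.Properties
  using (+↔⊎; *↔×; 1↔⊤; toℕ-↑ˡ; toℕ-↑ʳ; toℕ-cast; toℕ-combine;
         toℕ-inject₁; toℕ-fromℕ; toℕ-fromℕ<; fromℕ<-toℕ; toℕ<n)
open import Data.Fin.Permutation using (cast-id)
open import Data.Fin.Relation.Unary.Top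
  using (view; ‵fromℕ; ‵inject₁; view-fromℕ; view-inject₁)
open import Data.Product using (_×_; _,_; proj₁; proj₂; ∃-syntax)
open import Data.Product.Function.NonDependent.Propositional using (_×-↔_)
open import Data.Sum using (_⊎_; inj₁; inj₂)
open import Data.Sum.Function.Propositional using (_⊎-↔_)
open import Data.Unit using (⊤; tt)
open import Function.Bundles using (_↔_; _⤖_; Inverse; Bijection; mk↔ₛ′)
open import Function.Properties.Inverse using (↔-refl; ↔⇒⤖)
open import Function.Related.Propositional using (module EquationalReasoning; bijection)
open import Relation.Binary.PropositionalEquality
  using (_≡_; refl; sym; trans; cong; subst; subst₂; module ≡-Reasoning)
open import Relation.Nullary using (yes; no; contradiction)

suc↔⊎⊤ : ∀ {m} → Fin (suc m) ↔ (Fin m ⊎ ⊤)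
suc↔⊎⊤ {m} = mk↔ₛ′ split glue split-glue glue-split
  where
  split : Fin (suc m) → Fin m ⊎ ⊤
  split i with view i
  ... | ‵fromℕ     = inj₂ tt
  ... | ‵inject₁ j = inj₁ j

  glue : Fin m ⊎ ⊤ → Fin (suc m)
  glue (inj₁ j) = inject₁ j
  glue (inj₂ _) = fromℕ m

  split-glue : ∀ x → split (glue x) ≡ x
  split-glue (inj₁ j) rewrite view-inject₁ j = refl
  split-glue (inj₂ _) rewrite view-fromℕ m   = refl

  glue-split : ∀ i → glue (split i) ≡ i
  glue-split i with view i
  ... | ‵fromℕ     = refl
  ... | ‵inject₁ j = refl

coprime-suc : ∀ n → Coprime n (suc n)
coprime-suc n {d} (d∣n , d∣1+n) =
  ∣1⇒≡1 (∣m+n∣m⇒∣n (subst (d ∣_) (+-comm 1 n) d∣1+n) d∣n)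

coprime-1+m*i-1+m*[1+i] : ∀ m i → Coprime (suc (m * i)) (suc (m * suc i))
coprime-1+m*i-1+m*[1+i] m i {d} (d∣1+mi , d∣1+m[1+i]) =
  coprime-suc (m * i) (∣m⇒∣m*n i d∣m , d∣1+mi)
  where
  1+m[1+i]≡1+mi+m : suc (m * suc i) ≡ suc (m * i) + m
  1+m[1+i]≡1+mi+m = cong suc (trans (*-suc m i) (+-comm m (m * i)))

  d∣m : d ∣ m
  d∣m = ∣m+n∣m⇒∣n (subst (d ∣_) 1+m[1+i]≡1+mi+m d∣1+m[1+i]) d∣1+mi

module ConsecutiveEdgeLabels (G : Graph) {N : ℕ} (ℓ : (V G ⊎ E G) ⤖ Fin N) where

  label : V G ⊎ E G → ℕ
  label x = suc (toℕ (Bijection.to ℓ x))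

  HasConsecutiveEdges : V G → Set
  HasConsecutiveEdges v =
    ∃[ e ] ∃[ e′ ] (Incident G e v × Incident G e′ v × label (inj₂ e′) ≡ suc (label (inj₂ e)))

  totalPrimeLabeling :
    (∀ e → Coprime (label (inj₁ (proj₁ (ends G e)))) (label (inj₁ (proj₂ (ends G e))))) →
    (∀ v → HasConsecutiveEdges v) →
    TotalPrimeLabeling G N
  totalPrimeLabeling adjacent consecutive =
    record { ℓ = ℓ ; adjCoprime = adjacent ; edgeGcd = edgeGcd }
    where
    edgeGcd : ∀ v → DegAtLeast2 G v →
              ∀ d → (∀ e → Incident G e v → d ∣ label (inj₂ e)) → d ≡ 1
    edgeGcd v _ d d∣ with consecutive v
    ... | e , e′ , e∋v , e′∋v , e′≡1+e =
      coprime-suc (label (inj₂ e)) (d∣ e e∋v , subst (d ∣_) e′≡1+e (d∣ e′ e′∋v))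

module SnakeWalk (c b : ℕ) where

  k n : ℕ
  k = 2 + c
  n = 2 + b

  vertexBlocks : SnakeV k n ↔ (⊤ ⊎ Fin n × (Fin c ⊎ ⊤))
  vertexBlocks = mk↔ₛ′ split glue split-glue glue-split
    where
    split : SnakeV k n → ⊤ ⊎ Fin n × (Fin c ⊎ ⊤)
    split (pathV fzero)    = inj₁ tt
    split (pathV (fsuc i)) = inj₂ (i , inj₂ tt)
    split (innerV i j)     = inj₂ (i , inj₁ j)

    glue : ⊤ ⊎ Fin n × (Fin c ⊎ ⊤) → SnakeV k n
    glue (inj₁ _)            = pathV fzero
    glue (inj₂ (i , inj₁ j)) = innerV i j
    glue (inj₂ (i , inj₂ _)) = pathV (fsuc i)

    split-glue : ∀ x → split (glue x) ≡ x
    split-glue (inj₁ _)            = refl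
    split-glue (inj₂ (i , inj₁ j)) = refl
    split-glue (inj₂ (i , inj₂ _)) = refl

    glue-split : ∀ v → glue (split v) ≡ v
    glue-split (pathV fzero)    = refl
    glue-split (pathV (fsuc i)) = refl
    glue-split (innerV i j)     = refl

  edgeBlocks : SnakeE k n ↔ ((⊤ ⊎ Fin (suc c)) ⊎ Fin (suc b) × (Fin (suc c) ⊎ ⊤))
  edgeBlocks = mk↔ₛ′ split glue split-glue glue-split
    where
    split : SnakeE k n → (⊤ ⊎ Fin (suc c)) ⊎ Fin (suc b) × (Fin (suc c) ⊎ ⊤)
    split (pathE fzero)       = inj₁ (inj₁ tt)
    split (cycleE fzero t)    = inj₁ (inj₂ t)
    split (cycleE (fsuc i) t) = inj₂ (i , inj₁ t)
    split (pathE (fsuc i))    = inj₂ (i , inj₂ tt)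

    glue : (⊤ ⊎ Fin (suc c)) ⊎ Fin (suc b) × (Fin (suc c) ⊎ ⊤) → SnakeE k n
    glue (inj₁ (inj₁ _))     = pathE fzero
    glue (inj₁ (inj₂ t))     = cycleE fzero t
    glue (inj₂ (i , inj₁ t)) = cycleE (fsuc i) t
    glue (inj₂ (i , inj₂ _)) = pathE (fsuc i)

    split-glue : ∀ x → split (glue x) ≡ x
    split-glue (inj₁ (inj₁ _))     = refl
    split-glue (inj₁ (inj₂ t))     = refl
    split-glue (inj₂ (i , inj₁ t)) = refl
    split-glue (inj₂ (i , inj₂ _)) = refl

    glue-split : ∀ e → glue (split e) ≡ e
    glue-split (pathE fzero)       = refl
    glue-split (cycleE fzero t)    = refl
    glue-split (cycleE (fsuc i) t) = refl
    glue-split (pathE (fsuc i))    = refl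

  vertexWalk : SnakeV k n ↔ Fin (suc (n * suc c))
  vertexWalk = begin
    SnakeV k n                    ↔⟨ vertexBlocks ⟩
    (⊤ ⊎ Fin n × (Fin c ⊎ ⊤))     ↔⟨ 1↔⊤ ⊎-↔ (↔-refl ×-↔ suc↔⊎⊤) ⟨
    (Fin 1 ⊎ Fin n × Fin (suc c)) ↔⟨ ↔-refl ⊎-↔ *↔× ⟨
    (Fin 1 ⊎ Fin (n * suc c))     ↔⟨ +↔⊎ ⟨
    Fin (suc (n * suc c))         ∎
    where open EquationalReasoning {k = bijection}

  edgeWalk : SnakeE k n ↔ Fin (n * k)
  edgeWalk = begin
    SnakeE k n
      ↔⟨ edgeBlocks ⟩
    ((⊤ ⊎ Fin (suc c)) ⊎ Fin (suc b) × (Fin (suc c) ⊎ ⊤))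
      ↔⟨ (1↔⊤ ⊎-↔ ↔-refl) ⊎-↔ (↔-refl ×-↔ suc↔⊎⊤) ⟨
    ((Fin 1 ⊎ Fin (suc c)) ⊎ Fin (suc b) × Fin k)
      ↔⟨ +↔⊎ ⊎-↔ *↔× ⟨
    (Fin k ⊎ Fin (suc b * k))
      ↔⟨ +↔⊎ ⟨
    Fin (n * k)
      ∎
    where open EquationalReasoning {k = bijection}

  walk : (SnakeV k n ⊎ SnakeE k n) ↔ Fin (snakeLabelCount k n)
  walk = begin
    (SnakeV k n ⊎ SnakeE k n)             ↔⟨ vertexWalk ⊎-↔ edgeWalk ⟩
    (Fin (suc (n * suc c)) ⊎ Fin (n * k)) ↔⟨ cast-id (+-comm 1 (n * suc c)) ⊎-↔ ↔-refl ⟩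
    (Fin (n * suc c + 1) ⊎ Fin (n * k))   ↔⟨ +↔⊎ ⟨
    Fin (snakeLabelCount k n)             ∎
    where open EquationalReasoning {k = bijection}

  labeling : (SnakeV k n ⊎ SnakeE k n) ⤖ Fin (snakeLabelCount k n)
  labeling = ↔⇒⤖ walk

  open ConsecutiveEdgeLabels (Snake k n) labeling

  vertexPosition : SnakeV k n → ℕ
  vertexPosition v = toℕ (Inverse.to vertexWalk v)

  edgePosition : SnakeE k n → ℕ
  edgePosition e = toℕ (Inverse.to edgeWalk e)

  label-vertex : ∀ v → label (inj₁ v) ≡ suc (vertexPosition v)
  label-vertex v = cong suc (trans (toℕ-↑ˡ _ (n * k)) (toℕ-cast _ (Inverse.to vertexWalk v)))

  label-edge : ∀ e → label (inj₂ e) ≡ suc (n * suc c + 1 + edgePosition e)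
  label-edge e = cong suc (toℕ-↑ʳ (n * suc c + 1) (Inverse.to edgeWalk e))

  position-pathV : ∀ j → vertexPosition (pathV j) ≡ suc c * toℕ j
  position-pathV fzero    = sym (*-zeroʳ (suc c))
  position-pathV (fsuc i) = begin
    vertexPosition (pathV (fsuc i))     ≡⟨ cong suc (toℕ-combine i (fromℕ c)) ⟩
    suc (suc c * toℕ i + toℕ (fromℕ c)) ≡⟨ cong (λ x → suc (suc c * toℕ i + x)) (toℕ-fromℕ c) ⟩
    suc (suc c * toℕ i + c)             ≡⟨ cong suc (+-comm (suc c * toℕ i) c) ⟩
    suc c + suc c * toℕ i               ≡⟨ *-suc (suc c) (toℕ i) ⟨
    suc c * suc (toℕ i)                 ∎
    where open ≡-Reasoning

  position-innerV : ∀ i j → vertexPosition (innerV i j) ≡ suc (suc c * toℕ i + toℕ j)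
  position-innerV i j =
    cong suc (trans (toℕ-combine i (inject₁ j)) (cong (suc c * toℕ i +_) (toℕ-inject₁ j)))

  position-cycleNode : ∀ i s → s ≤ suc c →
                       vertexPosition (cycleNode k n i s) ≡ suc c * toℕ i + s
  position-cycleNode i zero _ = begin
    vertexPosition (pathV (inject₁ i)) ≡⟨ position-pathV (inject₁ i) ⟩
    suc c * toℕ (inject₁ i)            ≡⟨ cong (suc c *_) (toℕ-inject₁ i) ⟩
    suc c * toℕ i                      ≡⟨ +-identityʳ (suc c * toℕ i) ⟨
    suc c * toℕ i + 0                  ∎
    where open ≡-Reasoning
  position-cycleNode i (suc s) s<1+c with s <? c
  ... | yes s<c = begin
    vertexPosition (innerV i (fromℕ< s<c)) ≡⟨ position-innerV i (fromℕ< s<c) ⟩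
    suc (suc c * toℕ i + toℕ (fromℕ< s<c)) ≡⟨ cong (λ x → suc (suc c * toℕ i + x)) (toℕ-fromℕ< s<c) ⟩
    suc (suc c * toℕ i + s)                ≡⟨ +-suc (suc c * toℕ i) s ⟨
    suc c * toℕ i + suc s                  ∎
    where open ≡-Reasoning
  ... | no s≮c = begin
    vertexPosition (pathV (fsuc i)) ≡⟨ position-pathV (fsuc i) ⟩
    suc c * suc (toℕ i)             ≡⟨ *-suc (suc c) (toℕ i) ⟩
    suc c + suc c * toℕ i           ≡⟨ +-comm (suc c) (suc c * toℕ i) ⟩
    suc c * toℕ i + suc c           ≡⟨ cong (λ x → suc c * toℕ i + suc x) s≡c ⟨
    suc c * toℕ i + suc s           ∎
    where
    open ≡-Reasoning
    s≡c : s ≡ c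
    s≡c = ≤-antisym (s≤s⁻¹ s<1+c) (≮⇒≥ s≮c)

  cycleNode-inner : ∀ i (j : Fin c) → cycleNode k n i (suc (toℕ j)) ≡ innerV i j
  cycleNode-inner i j with toℕ j <? c
  ... | yes j<c = cong (innerV i) (fromℕ<-toℕ j j<c)
  ... | no j≮c  = contradiction (toℕ<n j) j≮c

  cycleNode-last : ∀ i → cycleNode k n i (suc (toℕ (fromℕ c))) ≡ pathV (fsuc i)
  cycleNode-last i with toℕ (fromℕ c) <? c
  ... | yes last<c = contradiction (subst (_< c) (toℕ-fromℕ c) last<c) (<-irrefl refl)
  ... | no _       = refl

  adjacent-coprime : ∀ e → Coprime (label (inj₁ (proj₁ (snakeEnds k n e))))
                                   (label (inj₁ (proj₂ (snakeEnds k n e))))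
  adjacent-coprime e = subst₂ Coprime (sym (label-vertex u)) (sym (label-vertex v)) (positions e)
    where
    u = proj₁ (snakeEnds k n e)
    v = proj₂ (snakeEnds k n e)

    positions : ∀ e → Coprime (suc (vertexPosition (proj₁ (snakeEnds k n e))))
                              (suc (vertexPosition (proj₂ (snakeEnds k n e))))
    positions (pathE i)
      rewrite position-pathV (inject₁ i) | position-pathV (fsuc i) | toℕ-inject₁ i =
      coprime-1+m*i-1+m*[1+i] (suc c) (toℕ i)
    positions (cycleE i t)
      rewrite position-cycleNode i (toℕ t) (<⇒≤ (toℕ<n t))
            | position-cycleNode i (suc (toℕ t)) (toℕ<n t)
            | +-suc (suc c * toℕ i) (toℕ t) =
      coprime-suc (suc (suc c * toℕ i + toℕ t))

  cycleStart : Fin n → ℕ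
  cycleStart fzero    = 1
  cycleStart (fsuc i) = k + k * toℕ i

  position-cycleE : ∀ i t → edgePosition (cycleE i t) ≡ cycleStart i + toℕ t
  position-cycleE fzero    t = cong suc (toℕ-↑ˡ t (suc b * k))
  position-cycleE (fsuc i) t = begin
    edgePosition (cycleE (fsuc i) t)   ≡⟨ toℕ-↑ʳ k (combine i (inject₁ t)) ⟩
    k + toℕ (combine i (inject₁ t))    ≡⟨ cong (k +_) (toℕ-combine i (inject₁ t)) ⟩
    k + (k * toℕ i + toℕ (inject₁ t))  ≡⟨ cong (λ x → k + (k * toℕ i + x)) (toℕ-inject₁ t) ⟩
    k + (k * toℕ i + toℕ t)            ≡⟨ +-assoc k (k * toℕ i) (toℕ t) ⟨
    k + k * toℕ i + toℕ t              ∎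
    where open ≡-Reasoning

  consecutive-positions : ∀ {v} e e′ →
                          Incident (Snake k n) e v → Incident (Snake k n) e′ v →
                          edgePosition e′ ≡ suc (edgePosition e) → HasConsecutiveEdges v
  consecutive-positions e e′ e∋v e′∋v e′≡1+e = e , e′ , e∋v , e′∋v , (begin
    label (inj₂ e′)                 ≡⟨ label-edge e′ ⟩
    suc (NV + edgePosition e′)      ≡⟨ cong (λ x → suc (NV + x)) e′≡1+e ⟩
    suc (NV + suc (edgePosition e)) ≡⟨ cong suc (+-suc NV (edgePosition e)) ⟩
    suc (suc (NV + edgePosition e)) ≡⟨ cong suc (label-edge e) ⟨
    suc (label (inj₂ e))            ∎)
    where
    open ≡-Reasoning
    NV = n * suc c + 1

  position-cycleE-fsuc : ∀ i j →
                         edgePosition (cycleE i (fsuc j)) ≡ suc (edgePosition (cycleE i (inject₁ j)))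
  position-cycleE-fsuc i j = begin
    edgePosition (cycleE i (fsuc j))          ≡⟨ position-cycleE i (fsuc j) ⟩
    cycleStart i + suc (toℕ j)                ≡⟨ +-suc (cycleStart i) (toℕ j) ⟩
    suc (cycleStart i + toℕ j)                ≡⟨ cong (λ x → suc (cycleStart i + x)) (toℕ-inject₁ j) ⟨
    suc (cycleStart i + toℕ (inject₁ j))      ≡⟨ cong suc (position-cycleE i (inject₁ j)) ⟨
    suc (edgePosition (cycleE i (inject₁ j))) ∎
    where open ≡-Reasoning

  position-cycleE-1-0 :
    edgePosition (cycleE (fsuc fzero) fzero) ≡ suc (edgePosition (cycleE fzero (fromℕ c)))
  position-cycleE-1-0 = begin
    edgePosition (cycleE (fsuc fzero) fzero)    ≡⟨ position-cycleE (fsuc fzero) fzero ⟩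
    k + k * 0 + 0                               ≡⟨ +-identityʳ (k + k * 0) ⟩
    k + k * 0                                   ≡⟨ cong (k +_) (*-zeroʳ k) ⟩
    k + 0                                       ≡⟨ +-identityʳ k ⟩
    suc (suc c)                                 ≡⟨ cong (λ x → suc (suc x)) (toℕ-fromℕ c) ⟨
    suc (suc (toℕ (fromℕ c)))                   ≡⟨ cong suc (position-cycleE fzero (fromℕ c)) ⟨
    suc (edgePosition (cycleE fzero (fromℕ c))) ∎
    where open ≡-Reasoning

  position-pathE-fsuc : ∀ i →
    edgePosition (pathE (fsuc i)) ≡ suc (edgePosition (cycleE (fsuc i) (fromℕ c)))
  position-pathE-fsuc i = begin
    edgePosition (pathE (fsuc i))                  ≡⟨ toℕ-↑ʳ k (combine i (fromℕ (suc c))) ⟩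
    k + toℕ (combine i (fromℕ (suc c)))            ≡⟨ cong (k +_) (toℕ-combine i (fromℕ (suc c))) ⟩
    k + (k * toℕ i + toℕ (fromℕ (suc c)))          ≡⟨ +-assoc k (k * toℕ i) _ ⟨
    cycleStart (fsuc i) + suc (toℕ (fromℕ c))      ≡⟨ +-suc (cycleStart (fsuc i)) (toℕ (fromℕ c)) ⟩
    suc (cycleStart (fsuc i) + toℕ (fromℕ c))      ≡⟨ cong suc (position-cycleE (fsuc i) (fromℕ c)) ⟨
    suc (edgePosition (cycleE (fsuc i) (fromℕ c))) ∎
    where open ≡-Reasoning

  consecutiveEdges : ∀ v → HasConsecutiveEdges v
  consecutiveEdges (pathV fzero) =
    consecutive-positions (pathE fzero) (cycleE fzero fzero) (inj₁ refl) (inj₁ refl) refl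
  consecutiveEdges (pathV (fsuc fzero)) =
    consecutive-positions (cycleE fzero (fromℕ c)) (cycleE (fsuc fzero) fzero)
      (inj₂ (cycleNode-last fzero)) (inj₁ refl) position-cycleE-1-0
  consecutiveEdges (pathV (fsuc (fsuc i))) =
    consecutive-positions (cycleE (fsuc i) (fromℕ c)) (pathE (fsuc i))
      (inj₂ (cycleNode-last (fsuc i))) (inj₂ refl) (position-pathE-fsuc i)
  consecutiveEdges (innerV i j) =
    consecutive-positions (cycleE i (inject₁ j)) (cycleE i (fsuc j))
      (inj₂ (trans (cong (λ s → cycleNode k n i (suc s)) (toℕ-inject₁ j))
                   (cycleNode-inner i j)))
      (inj₁ (cycleNode-inner i j))
      (position-cycleE-fsuc i j)

  snakeTotalPrime : TotalPrime (Snake k n) (snakeLabelCount k n)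
  snakeTotalPrime = totalPrimeLabeling adjacent-coprime consecutiveEdges

mainTheorem4 : ∀ (k n : ℕ) → k ≥ 3 → n ≥ 2 → TotalPrime (Snake k n) (snakeLabelCount k n)
mainTheorem4 (suc (suc c)) (suc (suc b)) _ _ = SnakeWalk.snakeTotalPrime c b
mainTheorem4 zero          _             ()            _
mainTheorem4 (suc zero)    _             (s≤s ())      _
mainTheorem4 (suc (suc _)) zero          _             ()
mainTheorem4 (suc (suc _)) (suc zero)    _             (s≤s ())
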